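{- Let $G$ be an undirected graph (possibly with loops and multiple edges), $w:V(G)\to\mathbb{N}$, $k$ a positive integer, and $R\subseteq V(G)$ a feedback vertex set of $G$ with $|R|=k+1$; let $F=G\setminus R$. Define $\mu=k+\rho(R)-(\eta+\tau)$, where $\rho(R)$ is the number of connected components of $G[R]$, $\eta$ is the number of nice vertices and $\tau$ the number of tents in $F$. If $\mu<0$, then there is no set $X\subseteq V(G)\setminus R$ with $|X|\le k$ such that $G\setminus X$ is a forest.
   Context: A feedback vertex set of $G$ is a set $S\subseteq V(G)$ such that $G\setminus S$ is a forest. A vertex $v\in V(F)$ is nice if $d_G(v)=2$ and both its neighbours are in $R$; it is a tent if $d_G(v)=3$ and all its neighbours are in $R$. Degrees count edge multiplicities. -}

module Defs where

open import Data.Nat using (ℕ; zero; suc; _+_; _<_; _≤_; s≤s; _<?_; _≡ᵇ_)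
open import Data.Bool using (Bool; true; false; _∧_; not; if_then_else_)
open import Data.Fin using (Fin; zero; suc; toℕ; fromℕ<; _≟_)
open import Data.Fin.Subset using (Subset; _∈_; _∉_; inside)
open import Data.List using (List; length; lookup; map; allFin)
open import Data.Nat.ListAction using (sum)
open import Data.Bool.ListAction using (and)
import Data.List.Membership.Propositional as LM
open import Data.Vec using () renaming (lookup to vlookup)
open import Data.Product using (Σ; ∃; _×_; _,_; proj₁; proj₂)
open import Data.Sum using (_⊎_)
open import Function.Definitions using (Injective)
open import Function.Bundles using (_⇔_)
open import Relation.Nullary using (¬_; yes; no)
open import Relation.Nullary.Decidable using (⌊_⌋)
open import Relation.Binary.PropositionalEquality using (_≡_)

-- A multigraph (loops and parallel edges allowed) on vertex set Fin n is a
-- list of edges; each edge is an unordered pair, stored as an ordered pair.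
Edges : ℕ → Set
Edges n = List (Fin n × Fin n)

Joins : ∀ {n} → Fin n × Fin n → Fin n → Fin n → Set
Joins e u v = (e ≡ (u , v)) ⊎ (e ≡ (v , u))

next : ∀ {m} → Fin (suc m) → Fin (suc m)
next {m} i with suc (toℕ i) <? suc m
... | yes p = fromℕ< p
... | no _  = zero

-- Length 1 = loop, length 2 = pair of parallel edges.
record CycleAvoiding {n} (E : Edges n) (S : Subset n) : Set where
  field
    m     : ℕ
    vs    : Fin (suc m) → Fin n
    es    : Fin (suc m) → Fin (length E)
    vs-inj : Injective _≡_ _≡_ vs
    es-inj : Injective _≡_ _≡_ es
    joins : ∀ i → Joins (lookup E (es i)) (vs i) (vs (next i))
    avoid : ∀ i → vs i ∉ S

IsForestMinus : ∀ {n} → Edges n → Subset n → Set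
IsForestMinus E S = ¬ CycleAvoiding E S

IsFVS : ∀ {n} → Edges n → Subset n → Set
IsFVS = IsForestMinus

-- degree counting multiplicities (a loop contributes 2)
deg : ∀ {n} → Edges n → Fin n → ℕ
deg E v = sum (map (λ e → ind (proj₁ e) + ind (proj₂ e)) E)
  where
    ind : _ → ℕ
    ind x = if ⌊ x ≟ v ⌋ then 1 else 0

nbrsInR : ∀ {n} → Edges n → Subset n → Fin n → Bool
nbrsInR E R v = and (map ok E)
  where
    ok : _ → Bool
    ok (a , b) = (if ⌊ a ≟ v ⌋ then vlookup R b else true)
               ∧ (if ⌊ b ≟ v ⌋ then vlookup R a else true)

isNice : ∀ {n} → Edges n → Subset n → Fin n → Bool
isNice E R v = not (vlookup R v) ∧ (deg E v ≡ᵇ 2) ∧ nbrsInR E R v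

isTent : ∀ {n} → Edges n → Subset n → Fin n → Bool
isTent E R v = not (vlookup R v) ∧ (deg E v ≡ᵇ 3) ∧ nbrsInR E R v

countV : ∀ {n} → (Fin n → Bool) → ℕ
countV {n} p = sum (map (λ v → if p v then 1 else 0) (allFin n))

η : ∀ {n} → Edges n → Subset n → ℕ
η E R = countV (isNice E R)

τ : ∀ {n} → Edges n → Subset n → ℕ
τ E R = countV (isTent E R)

data ReachIn {n} (E : Edges n) (R : Subset n) (u : Fin n) : Fin n → Set where
  here : u ∈ R → ReachIn E R u u
  step : ∀ {v x} → ReachIn E R u v → (Σ (Fin n × Fin n) λ e → e LM.∈ E × Joins e v x)
       → x ∈ R → ReachIn E R u x

-- G[R] has exactly ρ connected components: the components are labelled
-- bijectively by Fin ρ.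
NumComponents : ∀ {n} → Edges n → Subset n → ℕ → Set
NumComponents {n} E R ρ =
  Σ (Fin n → Fin ρ) λ c →
    (∀ u v → u ∈ R → v ∈ R → (c u ≡ c v) ⇔ ReachIn E R u v)
    × (∀ j → ∃ λ v → v ∈ R × c v ≡ j)

module Submission where

-- A nice vertex or tent outside X is not in R,
-- has no loop (its neighbours lie in R) and degree at least 2, so it has two distinct edges
-- into R; as η + τ > k + ρ ≥ ∣X∣ + ρ, there are at least ρ + 1 of them. Add them one at a
-- time to G[R] while keeping a labelling of the vertices added so far whose label classes
-- are connected. A vertex whose two edges end in the same class closes a cycle through
-- itself that avoids X; otherwise it merges two classes. The ρ initial classes cannot
-- absorb ρ + 1 merges, so G ∖ X has a cycle.

open import Defs
open import Data.Nat using (ℕ; _≤_; _+_)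
open import Data.Integer using (ℤ; +_; _-_; _<_)
open import Data.Fin using (Fin)
open import Data.Fin.Subset using (Subset; _⊆_; _∉_; ∣_∣)
open import Data.Product using (∃; _×_)
open import Relation.Nullary using (¬_)
open import Relation.Binary.PropositionalEquality using (_≡_)

import Algebra.Properties.CommutativeSemigroup as CommutativeSemigroupProperties
open import Data.Bool using (Bool; true; false; T; not; _∧_; _∨_; if_then_else_)
open import Data.Bool.Properties using (T-≡; T-∧; T-∨)
open import Data.Empty using (⊥-elim)
open import Data.Fin as Fin using (zero; suc; toℕ; fromℕ; inject₁; punchIn; punchOut; _≟_)
import Data.Fin.Properties as Fin
open import Data.Fin.Subset using (_∈_; _∪_; ⁅_⁆)
open import Data.Fin.Subset.Properties using (p⊆p∪q; x∈p∪q⁺; x∈p∪q⁻; x∈⁅x⁆; x∈⁅y⁆⇒x≡y)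
open import Data.Integer using (+<+)
import Data.Integer.Properties as ℤ
open import Data.List using (List; []; _∷_; length; lookup; map; filterᵇ; allFin)
open import Data.List.Properties using (map-tabulate)
open import Data.List.Membership.Propositional using () renaming (_∈_ to _∈ₗ_)
open import Data.List.Membership.Propositional.Properties using (∈-lookup; ∈-filter⁻)
open import Data.List.Relation.Unary.All as All using (All; _∷_)
open import Data.List.Relation.Unary.All.Properties using (all⁺)
open import Data.List.Relation.Unary.AllPairs using (_∷_)
open import Data.List.Relation.Unary.Any using (index)
open import Data.List.Relation.Unary.Any.Properties using (lookup-index)
open import Data.List.Relation.Unary.Unique.Propositional using (Unique)
open import Data.List.Relation.Unary.Unique.Propositional.Properties using (filter⁺; allFin⁺)
open import Data.Nat as ℕ using (zero; suc; s≤s; z≤n)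
import Data.Nat.Properties as ℕ
open import Data.Nat.ListAction using (sum)
open import Data.Product as Prod using (Σ; ∃₂; _,_; proj₁; proj₂)
open import Data.Sum as Sum using (_⊎_; inj₁; inj₂)
import Data.Vec as Vec
open import Data.Vec using () renaming (lookup to vlookup)
open import Data.Vec.Functional using (insertAt; updateAt)
open import Data.Vec.Functional.Properties
  using (insertAt-lookup; insertAt-punchIn; updateAt-updates; updateAt-minimal)
open import Data.Vec.Properties using (lookup⇒[]=; []=⇒lookup)
open import Function using (_∘_; id)
open import Function.Bundles using (Equivalence)
open import Function.Definitions using (Injective)
open import Relation.Nullary using (yes; no; contradiction)
open import Relation.Nullary.Decidable using (⌊_⌋; T?)
open import Relation.Binary.PropositionalEquality
  using (_≢_; refl; sym; trans; cong; cong₂; subst; module ≡-Reasoning)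

private
  variable
    m : ℕ

data TopView {m : ℕ} : Fin (suc m) → Set where
  top : TopView (fromℕ m)
  inj : (i : Fin m) → TopView (inject₁ i)

topView : ∀ m (i : Fin (suc m)) → TopView i
topView zero    zero    = top
topView (suc m) zero    = inj zero
topView (suc m) (suc i) with topView m i
... | top   = top
... | inj j = inj (suc j)

next-inject₁ : (i : Fin m) → next (inject₁ i) ≡ suc i
next-inject₁ {m} i with suc (toℕ (inject₁ i)) ℕ.<? suc m
... | yes p = Fin.toℕ-injective (trans (Fin.toℕ-fromℕ< p) (cong suc (Fin.toℕ-inject₁ i)))
... | no ¬p = contradiction (s≤s (subst (ℕ._< m) (sym (Fin.toℕ-inject₁ i)) (Fin.toℕ<n i))) ¬p

next-fromℕ : ∀ m → next (fromℕ m) ≡ zero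
next-fromℕ m with suc (toℕ (fromℕ m)) ℕ.<? suc m
... | yes p = contradiction (subst (λ t → suc t ℕ.< suc m) (Fin.toℕ-fromℕ m) p) (ℕ.<-irrefl refl)
... | no _  = refl

punchIn-fromℕ : (i : Fin m) → punchIn (fromℕ m) i ≡ inject₁ i
punchIn-fromℕ zero    = refl
punchIn-fromℕ (suc i) = cong suc (punchIn-fromℕ i)

module _ {n : ℕ} where

  joins-sym : ∀ {e : Fin n × Fin n} {u v} → Joins e u v → Joins e v u
  joins-sym = Sum.swap

  joins-endpoint : ∀ {e : Fin n × Fin n} {u v x y} → Joins e u v → Joins e x y → x ≡ u ⊎ x ≡ v
  joins-endpoint (inj₁ refl) (inj₁ refl) = inj₁ refl
  joins-endpoint (inj₁ refl) (inj₂ refl) = inj₂ refl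
  joins-endpoint (inj₂ refl) (inj₁ refl) = inj₂ refl
  joins-endpoint (inj₂ refl) (inj₂ refl) = inj₁ refl

  Adjacent : Edges n → Fin n → Fin n → Set
  Adjacent E u v = Σ (Fin n × Fin n) λ e → e ∈ₗ E × Joins e u v

-- Walks in induced subgraphs

module _ {n : ℕ} {E : Edges n} where

  private
    variable
      W W′ : Subset n
      u v x : Fin n

  reach-end : ReachIn E W u v → v ∈ W
  reach-end (here u∈W)     = u∈W
  reach-end (step _ _ v∈W) = v∈W

  reach-trans : ReachIn E W u v → ReachIn E W v x → ReachIn E W u x
  reach-trans ρ (here _)       = ρ
  reach-trans ρ (step σ e x∈W) = step (reach-trans ρ σ) e x∈W

  reach-sym : ReachIn E W u v → ReachIn E W v u
  reach-sym (here u∈W) = here u∈W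
  reach-sym (step ρ (e , e∈E , j) x∈W) =
    reach-trans (step (here x∈W) (e , e∈E , joins-sym j) (reach-end ρ)) (reach-sym ρ)

  reach-mono : W ⊆ W′ → ReachIn E W u v → ReachIn E W′ u v
  reach-mono W⊆W′ (here u∈W)     = here (W⊆W′ u∈W)
  reach-mono W⊆W′ (step ρ e x∈W) = step (reach-mono W⊆W′ ρ) e (W⊆W′ x∈W)

-- Simple paths and the cycles they close

module _ {n : ℕ} (E : Edges n) where

  private
    variable
      W X : Subset n
      u v x p r s : Fin n

  infixl 5 _▷_
  data Path (u : Fin n) : Fin n → Set where
    [_] : Path u u
    _▷_ : ∀ {v x} → Path u v → Σ (Fin (length E)) (λ e → Joins (lookup E e) v x) → Path u x

  len : Path u v → ℕ
  len [_]     = 0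
  len (π ▷ _) = suc (len π)

  -- Vertices are numbered backwards from the end of the path.
  vertex : (π : Path u v) → Fin (suc (len π)) → Fin n
  vertex {v = v} π zero = v
  vertex (π ▷ _) (suc i) = vertex π i

  edge : (π : Path u v) → Fin (len π) → Fin (length E)
  edge (π ▷ (e , _)) zero    = e
  edge (π ▷ _)       (suc i) = edge π i

  vertex-start : (π : Path u v) → vertex π (fromℕ (len π)) ≡ u
  vertex-start [_]     = refl
  vertex-start (π ▷ _) = vertex-start π

  edge-joins : (π : Path u v) (i : Fin (len π)) →
               Joins (lookup E (edge π i)) (vertex π (suc i)) (vertex π (inject₁ i))
  edge-joins (π ▷ (_ , j)) zero    = j
  edge-joins (π ▷ _)       (suc i) = edge-joins π i

  _∈ₚ_ : Fin n → Path u v → Set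
  x ∈ₚ π = ∃ λ i → vertex π i ≡ x

  endpoint-∈ₚ : ∀ {y z} (π : Path u v) (i : Fin (len π)) → Joins (lookup E (edge π i)) y z → y ∈ₚ π
  endpoint-∈ₚ π i j with joins-endpoint (edge-joins π i) j
  ... | inj₁ y≡ = suc i , sym y≡
  ... | inj₂ y≡ = inject₁ i , sym y≡

  Simple : Path u v → Set
  Simple π = Injective _≡_ _≡_ (vertex π)

  [-]-simple : Simple ([_] {u})
  [-]-simple {_} {zero} {zero} _ = refl

  ▷-simple : (π : Path u v) {e : Σ (Fin (length E)) (λ e → Joins (lookup E e) v x)} →
             Simple π → ¬ x ∈ₚ π → Simple (π ▷ e)
  ▷-simple π s x∉π {zero}  {zero}  _  = refl
  ▷-simple π s x∉π {zero}  {suc j} eq = contradiction (j , sym eq) x∉π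
  ▷-simple π s x∉π {suc i} {zero}  eq = contradiction (i , eq) x∉π
  ▷-simple π s x∉π {suc i} {suc j} eq = cong suc (s eq)

  ▷-simple⁻ : (π : Path u v) {e : Σ (Fin (length E)) (λ e → Joins (lookup E e) v x)} →
              Simple (π ▷ e) → Simple π × ¬ x ∈ₚ π
  ▷-simple⁻ π s = Fin.suc-injective ∘ s , λ (i , eq) → contradiction (s {suc i} {zero} eq) λ ()

  ▷-edge-new : (π : Path u v) {e : Fin (length E)} (j : Joins (lookup E e) v x) →
               Simple (π ▷ (e , j)) → ∀ k → e ≢ edge π k
  ▷-edge-new π j s k e≡ =
    proj₂ (▷-simple⁻ π s) (endpoint-∈ₚ π k (subst (λ e → Joins (lookup E e) _ _) e≡ (joins-sym j)))

  edge-injective : (π : Path u v) → Simple π → Injective _≡_ _≡_ (edge π)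
  edge-injective (π ▷ _)       s {zero}  {zero}  _  = refl
  edge-injective (π ▷ (_ , j)) s {zero}  {suc k} eq = contradiction eq (▷-edge-new π j s k)
  edge-injective (π ▷ (_ , j)) s {suc i} {zero}  eq = contradiction (sym eq) (▷-edge-new π j s i)
  edge-injective (π ▷ _)       s {suc i} {suc k} eq = cong suc (edge-injective π (proj₁ (▷-simple⁻ π s)) eq)

  -- As next wraps fromℕ (len π) round to zero, the closing edge c, from u back to v, goes last.
  close : (π : Path u v) → Simple π → (∀ i → vertex π i ∉ X) →
          (c : Fin (length E)) → Joins (lookup E c) u v → (∀ i → edge π i ≢ c) → CycleAvoiding E X
  close π s avoid c jc c-new = record
    { m = len π ; vs = vertex π ; es = es ; vs-inj = s ; es-inj = es-injective
    ; joins = joins ; avoid = avoid }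
    where
    es : Fin (suc (len π)) → Fin (length E)
    es = insertAt (edge π) (fromℕ (len π)) c

    es-top : es (fromℕ (len π)) ≡ c
    es-top = insertAt-lookup (edge π) (fromℕ (len π)) c

    es-inject₁ : ∀ i → es (inject₁ i) ≡ edge π i
    es-inject₁ i = trans (cong es (sym (punchIn-fromℕ i))) (insertAt-punchIn (edge π) (fromℕ (len π)) c i)

    es-injective : Injective _≡_ _≡_ es
    es-injective {i} {k} eq with topView (len π) i | topView (len π) k
    ... | top   | top   = refl
    ... | top   | inj b = contradiction (trans (sym (es-inject₁ b)) (trans (sym eq) es-top)) (c-new b)
    ... | inj a | top   = contradiction (trans (sym (es-inject₁ a)) (trans eq es-top)) (c-new a)
    ... | inj a | inj b = cong inject₁ (edge-injective π s (trans (sym (es-inject₁ a)) (trans eq (es-inject₁ b))))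

    joins : ∀ i → Joins (lookup E (es i)) (vertex π i) (vertex π (next i))
    joins i with topView (len π) i
    ... | top   rewrite es-top | next-fromℕ (len π) | vertex-start π = jc
    ... | inj a rewrite es-inject₁ a | next-inject₁ a = joins-sym (edge-joins π a)

  record SimplePathIn (W : Subset n) (u v : Fin n) : Set where
    constructor simplePath
    field
      path   : Path u v
      simple : Simple path
      inside : ∀ i → vertex path i ∈ W

  truncate : (σ : SimplePathIn W u v) → x ∈ₚ SimplePathIn.path σ → SimplePathIn W u x
  truncate σ                             (zero , refl) = σ
  truncate (simplePath (π ▷ _) s inside) (suc i , eq)  =
    truncate (simplePath π (proj₁ (▷-simple⁻ π s)) (inside ∘ suc)) (i , eq)

  simplify : ReachIn E W u v → SimplePathIn W u v
  simplify (here u∈W) = simplePath [_] [-]-simple λ { zero → u∈W }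
  simplify {v = x} (step ρ (e , e∈E , j) x∈W) with simplify ρ
  ... | σ@(simplePath π s inside) with Fin.any? (λ i → vertex π i ≟ x)
  ...   | yes x∈π = truncate σ x∈π
  ...   | no  x∉π =
    simplePath (π ▷ (index e∈E , j′)) (▷-simple π s x∉π) λ { zero → x∈W ; (suc i) → inside i }
    where
    j′ = subst (λ e → Joins e _ x) (lookup-index e∈E) j

  cycle-through : SimplePathIn W r s → (∀ {y} → y ∈ W → y ∉ X) → p ∉ W → p ∉ X →
                  ∀ {a b} → a ≢ b → Joins (lookup E a) p r → Joins (lookup E b) p s → CycleAvoiding E X
  cycle-through {W = W} {X = X} {p = p} (simplePath π s inside) W∩X=∅ p∉W p∉X {a} {b} a≢b ja jb =
    close (π ▷ (b , joins-sym jb)) (▷-simple π s p∉π) avoid a (joins-sym ja) a-new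
    where
    p∉π : ¬ p ∈ₚ π
    p∉π (i , refl) = p∉W (inside i)

    avoid : ∀ i → vertex (π ▷ (b , joins-sym jb)) i ∉ X
    avoid zero    = p∉X
    avoid (suc i) = W∩X=∅ (inside i)

    a-new : ∀ i → edge (π ▷ (b , joins-sym jb)) i ≢ a
    a-new zero    = a≢b ∘ sym
    a-new (suc i) refl = p∉π (endpoint-∈ₚ π i ja)

-- Merging label classes

OneOf : ∀ {m} → Fin m → Fin m → Fin m → Set
OneOf A B z = z ≡ A ⊎ z ≡ B

identify : (A B : Fin (suc m)) → A ≢ B → Fin (suc m) → Fin m
identify A B A≢B z with z ≟ B
... | yes _   = punchOut {i = B} {j = A} (A≢B ∘ sym)
... | no  z≢B = punchOut {i = B} {j = z} (z≢B ∘ sym)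

identify-fibres : (A B : Fin (suc m)) (A≢B : A ≢ B) {z z′ : Fin (suc m)} →
                  identify A B A≢B z ≡ identify A B A≢B z′ → z ≡ z′ ⊎ (OneOf A B z × OneOf A B z′)
identify-fibres A B A≢B {z} {z′} eq with z ≟ B | z′ ≟ B
... | yes z≡B | yes z′≡B = inj₁ (trans z≡B (sym z′≡B))
... | yes z≡B | no  z′≢B = inj₂ (inj₂ z≡B , inj₁ (sym (Fin.punchOut-injective (A≢B ∘ sym) (z′≢B ∘ sym) eq)))
... | no  z≢B | yes z′≡B = inj₂ (inj₁ (Fin.punchOut-injective (z≢B ∘ sym) (A≢B ∘ sym) eq) , inj₂ z′≡B)
... | no  z≢B | no  z′≢B = inj₁ (Fin.punchOut-injective (z≢B ∘ sym) (z′≢B ∘ sym) eq)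

module _ {n : ℕ} (E : Edges n) where

  private
    variable
      W X : Subset n
      x y : Fin n

  ClassesConnected : Subset n → (Fin n → Fin m) → Set
  ClassesConnected W ℓ = ∀ {u v} → u ∈ W → v ∈ W → ℓ u ≡ ℓ v → ReachIn E W u v

  ∈-∪⁅⁆⁻ : x ∈ W ∪ ⁅ y ⁆ → x ∈ W ⊎ x ≡ y
  ∈-∪⁅⁆⁻ {W = W} {y = y} x∈ = Sum.map₂ (x∈⁅y⁆⇒x≡y y) (x∈p∪q⁻ W ⁅ y ⁆ x∈)

  module Merge {W : Subset n} {p r s : Fin n} {ℓ : Fin n → Fin (suc m)}
               (conn : ClassesConnected W ℓ) (p∉W : p ∉ W) (r∈W : r ∈ W) (s∈W : s ∈ W)
               (rp : Adjacent E r p) (sp : Adjacent E s p) (ℓr≢ℓs : ℓ r ≢ ℓ s) where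

    ℓ⁺ : Fin n → Fin (suc m)
    ℓ⁺ = updateAt ℓ p λ _ → ℓ r

    merged : Fin n → Fin m
    merged = identify (ℓ r) (ℓ s) ℓr≢ℓs ∘ ℓ⁺

    ℓ⁺-p : ℓ⁺ p ≡ ℓ r
    ℓ⁺-p = updateAt-updates p ℓ

    ℓ⁺-old : x ∈ W → ℓ⁺ x ≡ ℓ x
    ℓ⁺-old {x} x∈W = updateAt-minimal x p ℓ λ { refl → p∉W x∈W }

    widen : ∀ {x y} → ReachIn E W x y → ReachIn E (W ∪ ⁅ p ⁆) x y
    widen = reach-mono (p⊆p∪q ⁅ p ⁆)

    p∈W∪⁅p⁆ : p ∈ W ∪ ⁅ p ⁆
    p∈W∪⁅p⁆ = x∈p∪q⁺ (inj₂ (x∈⁅x⁆ p))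

    to-p : x ∈ W ∪ ⁅ p ⁆ → OneOf (ℓ r) (ℓ s) (ℓ⁺ x) → ReachIn E (W ∪ ⁅ p ⁆) x p
    to-p x∈ class with ∈-∪⁅⁆⁻ x∈ | class
    ... | inj₂ refl | _        = here x∈
    ... | inj₁ x∈W  | inj₁ x~r = step (widen (conn x∈W r∈W (trans (sym (ℓ⁺-old x∈W)) x~r))) rp p∈W∪⁅p⁆
    ... | inj₁ x∈W  | inj₂ x~s = step (widen (conn x∈W s∈W (trans (sym (ℓ⁺-old x∈W)) x~s))) sp p∈W∪⁅p⁆

    through-p : ∀ {u v} → u ∈ W ∪ ⁅ p ⁆ → v ∈ W ∪ ⁅ p ⁆ →
                OneOf (ℓ r) (ℓ s) (ℓ⁺ u) → OneOf (ℓ r) (ℓ s) (ℓ⁺ v) → ReachIn E (W ∪ ⁅ p ⁆) u v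
    through-p u∈ v∈ u-class v-class = reach-trans (to-p u∈ u-class) (reach-sym (to-p v∈ v-class))

    connected : ClassesConnected (W ∪ ⁅ p ⁆) merged
    connected u∈ v∈ eq with identify-fibres (ℓ r) (ℓ s) ℓr≢ℓs eq
    ... | inj₂ (u-class , v-class) = through-p u∈ v∈ u-class v-class
    ... | inj₁ same with ∈-∪⁅⁆⁻ u∈ | ∈-∪⁅⁆⁻ v∈
    ...   | inj₁ u∈W  | inj₁ v∈W  =
      widen (conn u∈W v∈W (trans (sym (ℓ⁺-old u∈W)) (trans same (ℓ⁺-old v∈W))))
    ...   | inj₂ refl | _         = through-p u∈ v∈ (inj₁ ℓ⁺-p) (inj₁ (trans (sym same) ℓ⁺-p))
    ...   | inj₁ _    | inj₂ refl = through-p u∈ v∈ (inj₁ (trans same ℓ⁺-p)) (inj₁ ℓ⁺-p)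

  record DoublyAttached (R : Subset n) (p : Fin n) : Set where
    constructor attached
    field
      a b : Fin (length E)
      a≢b : a ≢ b
      r s : Fin n
      r∈R : r ∈ R
      s∈R : s ∈ R
      pr  : Joins (lookup E a) p r
      ps  : Joins (lookup E b) p s

  ∉-∪⁅⁆ : x ∉ W → y ≢ x → x ∉ W ∪ ⁅ y ⁆
  ∉-∪⁅⁆ x∉W y≢x x∈ = Sum.[ x∉W , y≢x ∘ sym ] (∈-∪⁅⁆⁻ x∈)

  cycle-of-attached : ∀ {R} m (W : Subset n) (ℓ : Fin n → Fin m) → ClassesConnected W ℓ → R ⊆ W →
                      (∀ {y} → y ∈ W → y ∉ X) → (ps : List (Fin n)) → Unique ps → All (_∉ W) ps →
                      All (λ p → p ∉ X × DoublyAttached R p) ps → m ℕ.< length ps → CycleAvoiding E X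
  cycle-of-attached zero W ℓ _ _ _ (_ ∷ _) _ _ ((_ , attached _ _ _ r _ _ _ _ _) ∷ _) _ with ℓ r
  ... | ()
  cycle-of-attached {X = X} (suc m) W ℓ conn R⊆W W∩X=∅ (p ∷ ps) (p∉ps ∷ unique) (p∉W ∷ ∉W)
                    ((p∉X , attached a b a≢b r s r∈R s∈R pr ps′) ∷ atts) (s≤s m<len) with ℓ r ≟ ℓ s
  ... | yes same = cycle-through E (simplify E (conn (R⊆W r∈R) (R⊆W s∈R) same)) W∩X=∅ p∉W p∉X a≢b pr ps′
  ... | no differ = cycle-of-attached m (W ∪ ⁅ p ⁆) merged connected (p⊆p∪q ⁅ p ⁆ ∘ R⊆W) W∩X=∅′
                      ps unique (All.zipWith (λ (x∉W , p≢x) → ∉-∪⁅⁆ x∉W p≢x) (∉W , p∉ps)) atts m<len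
    where
    open Merge conn p∉W (R⊆W r∈R) (R⊆W s∈R) (lookup E a , ∈-lookup a , joins-sym pr)
                                             (lookup E b , ∈-lookup b , joins-sym ps′) differ
    W∩X=∅′ : ∀ {y} → y ∈ W ∪ ⁅ p ⁆ → y ∉ X
    W∩X=∅′ y∈ with ∈-∪⁅⁆⁻ y∈
    ... | inj₁ y∈W  = W∩X=∅ y∈W
    ... | inj₂ refl = p∉X

-- Counting nice vertices and tents

∧₃-split : ∀ x y {z} → T (x ∧ y ∧ z) → T x × T y × T z
∧₃-split true true t = _ , _ , t

indicator : Bool → ℕ
indicator b = if b then 1 else 0

module _ {A : Set} (f : A → ℕ) {P : A → Set} where

  ZeroOrOne : A → Set
  ZeroOrOne x = f x ≡ 0 ⊎ (f x ≡ 1 × P x)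

  witness : (xs : List A) → All ZeroOrOne xs → 1 ≤ sum (map f xs) → ∃ λ i → P (lookup xs i)
  witness (x ∷ xs) (inj₂ (_ , px) ∷ _) _ = zero , px
  witness (x ∷ xs) (inj₁ fx≡0 ∷ zo) 1≤Σ =
    Prod.map suc id (witness xs zo (subst (λ t → 1 ≤ t + sum (map f xs)) fx≡0 1≤Σ))

  two-witnesses : (xs : List A) → All ZeroOrOne xs → 2 ≤ sum (map f xs) →
                  ∃₂ λ i j → i ≢ j × P (lookup xs i) × P (lookup xs j)
  two-witnesses (x ∷ xs) (inj₂ (fx≡1 , px) ∷ zo) 2≤Σ =
    let (j , pj) = witness xs zo (ℕ.s≤s⁻¹ (subst (λ t → 2 ≤ t + sum (map f xs)) fx≡1 2≤Σ))
    in zero , suc j , (λ ()) , px , pj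
  two-witnesses (x ∷ xs) (inj₁ fx≡0 ∷ zo) 2≤Σ =
    let (i , j , i≢j , pi , pj) = two-witnesses xs zo (subst (λ t → 2 ≤ t + sum (map f xs)) fx≡0 2≤Σ)
    in suc i , suc j , i≢j ∘ Fin.suc-injective , pi , pj

T⇒∈ : ∀ {n} {R : Subset n} {x} → T (vlookup R x) → x ∈ R
T⇒∈ {R = R} {x} t = lookup⇒[]= x R (Equivalence.to T-≡ t)

T-not⇒∉ : ∀ {n} {R : Subset n} {x} → T (not (vlookup R x)) → x ∉ R
T-not⇒∉ {R = R} {x} t x∈R rewrite []=⇒lookup x∈R = t

module _ {n : ℕ} (E : Edges n) (R : Subset n) (v : Fin n) where

  incidence : Fin n × Fin n → ℕ
  incidence (a , b) = indicator ⌊ a ≟ v ⌋ + indicator ⌊ b ≟ v ⌋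

  neighbourInR : Fin n × Fin n → Bool
  neighbourInR (a , b) = (if ⌊ a ≟ v ⌋ then vlookup R b else true) ∧ (if ⌊ b ≟ v ⌋ then vlookup R a else true)

  -- A loop at v would make v its own neighbour, so v ∉ R rules it out.
  incident-edge : T (not (vlookup R v)) → (e : Fin n × Fin n) → T (neighbourInR e) →
                  ZeroOrOne incidence {λ e → ∃ λ r → r ∈ R × Joins e v r} e
  incident-edge v∉R (a , b) ok with a ≟ v | b ≟ v
  ... | no  _    | no  _    = inj₁ refl
  ... | yes refl | no  _    = inj₂ (refl , b , T⇒∈ (proj₁ (Equivalence.to T-∧ ok)) , inj₁ refl)
  ... | no  _    | yes refl = inj₂ (refl , a , T⇒∈ ok , inj₂ refl)
  ... | yes refl | yes refl with vlookup R v
  ...   | true  = ⊥-elim v∉R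
  ...   | false = ⊥-elim ok

  attached-of-degree : T (not (vlookup R v)) → T (nbrsInR E R v) → 2 ≤ deg E v → DoublyAttached E R v
  attached-of-degree v∉R nbrs 2≤deg =
    let (i , j , i≢j , (r , r∈R , vr) , (s , s∈R , vs)) =
          two-witnesses incidence E (All.map (λ {e} → incident-edge v∉R e) (all⁺ neighbourInR E nbrs)) 2≤deg
    in attached i j i≢j r s r∈R s∈R vr vs

  nice-or-tent-attached : T (isNice E R v ∨ isTent E R v) → v ∉ R × DoublyAttached E R v
  nice-or-tent-attached t = Sum.[ outside-attached 0 , outside-attached 1 ] (Equivalence.to T-∨ t)
    where
    outside-attached : ∀ d → T (not (vlookup R v) ∧ (deg E v ℕ.≡ᵇ suc (suc d)) ∧ nbrsInR E R v) →
                       v ∉ R × DoublyAttached E R v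
    outside-attached d t =
      let (v∉R , deg≡ , nbrs) = ∧₃-split (not (vlookup R v)) (deg E v ℕ.≡ᵇ suc (suc d)) t
      in T-not⇒∉ v∉R ,
         attached-of-degree v∉R nbrs (subst (2 ≤_) (sym (ℕ.≡ᵇ⇒≡ (deg E v) _ deg≡)) (s≤s (s≤s z≤n)))

  ¬nice-and-tent : ¬ (T (isNice E R v) × T (isTent E R v))
  ¬nice-and-tent (nice , tent) =
    contradiction (trans (sym (degree-of 2 nice)) (degree-of 3 tent)) λ ()
    where
    degree-of : ∀ d → T (not (vlookup R v) ∧ (deg E v ℕ.≡ᵇ d) ∧ nbrsInR E R v) → deg E v ≡ d
    degree-of d t =
      ℕ.≡ᵇ⇒≡ (deg E v) d (proj₁ (proj₂ (∧₃-split (not (vlookup R v)) (deg E v ℕ.≡ᵇ d) t)))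

length-filterᵇ : ∀ {A : Set} (q : A → Bool) xs → length (filterᵇ q xs) ≡ sum (map (indicator ∘ q) xs)
length-filterᵇ q []       = refl
length-filterᵇ q (x ∷ xs) with q x
... | true  = cong suc (length-filterᵇ q xs)
... | false = length-filterᵇ q xs

sum-map-+-mono : ∀ {A : Set} (f g h k : A → ℕ) xs → (∀ x → f x + g x ≤ h x + k x) →
                 sum (map f xs) + sum (map g xs) ≤ sum (map h xs) + sum (map k xs)
sum-map-+-mono f g h k []       _  = z≤n
sum-map-+-mono f g h k (x ∷ xs) le = begin
  (f x + sum (map f xs)) + (g x + sum (map g xs)) ≡⟨ interchange (f x) _ (g x) _ ⟩
  (f x + g x) + (sum (map f xs) + sum (map g xs)) ≤⟨ ℕ.+-mono-≤ (le x) (sum-map-+-mono f g h k xs le) ⟩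
  (h x + k x) + (sum (map h xs) + sum (map k xs)) ≡⟨ interchange (h x) (k x) _ _ ⟩
  (h x + sum (map h xs)) + (k x + sum (map k xs)) ∎
  where open ℕ.≤-Reasoning
        open CommutativeSemigroupProperties ℕ.+-commutativeSemigroup using (interchange)

countV-suc : ∀ {n} (q : Fin (suc n) → Bool) → countV q ≡ indicator (q zero) + countV (q ∘ suc)
countV-suc {n} q = cong (ℕ._+_ (indicator (q zero))) (cong sum
  (trans (map-tabulate suc (indicator ∘ q)) (sym (map-tabulate id (indicator ∘ q ∘ suc)))))

countV-∣∣ : ∀ {n} (X : Subset n) → countV (vlookup X) ≡ ∣ X ∣
countV-∣∣ Vec.[]      = refl
countV-∣∣ (x Vec.∷ X) = begin
  countV (vlookup (x Vec.∷ X))  ≡⟨ countV-suc (vlookup (x Vec.∷ X)) ⟩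
  indicator x + countV (vlookup X) ≡⟨ cong (ℕ._+_ (indicator x)) (countV-∣∣ X) ⟩
  indicator x + ∣ X ∣             ≡⟨ size-cons x ⟩
  ∣ x Vec.∷ X ∣                  ∎
  where
  open ≡-Reasoning
  size-cons : ∀ x → indicator x + ∣ X ∣ ≡ ∣ x Vec.∷ X ∣
  size-cons true  = refl
  size-cons false = refl

indicator-∨ : ∀ a b x → ¬ (T a × T b) →
              indicator a + indicator b ≤ indicator ((a ∨ b) ∧ not x) + indicator x
indicator-∨ true  true  _     ¬ab = contradiction _ ¬ab
indicator-∨ true  false true  _   = s≤s z≤n
indicator-∨ true  false false _   = s≤s z≤n
indicator-∨ false true  true  _   = s≤s z≤n
indicator-∨ false true  false _   = s≤s z≤n
indicator-∨ false false _     _   = z≤n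

m-n<0⇒m<n : ∀ m n → + m - + n < + 0 → m ℕ.< n
m-n<0⇒m<n m n m-n<0 with n ℕ.≤? m
... | no  n≰m = ℕ.≰⇒> n≰m
... | yes n≤m with subst (_< + 0) (trans (ℤ.m-n≡m⊖n m n) (ℤ.⊖-≥ n≤m)) m-n<0
...   | +<+ ()

module _ {n : ℕ} (E : Edges n) (R X : Subset n) where

  candidate : Fin n → Bool
  candidate v = (isNice E R v ∨ isTent E R v) ∧ not (vlookup X v)

  candidates : List (Fin n)
  candidates = filterᵇ candidate (allFin n)

  candidates-unique : Unique candidates
  candidates-unique = filter⁺ (T? ∘ candidate) (allFin⁺ n)

  candidate-attached : ∀ {v} → v ∈ₗ candidates → v ∉ R × v ∉ X × DoublyAttached E R v
  candidate-attached {v} v∈ =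
    let (nice-or-tent , v∉X) = Equivalence.to (T-∧ {isNice E R v ∨ isTent E R v})
                                 (proj₂ (∈-filter⁻ (T? ∘ candidate) {xs = allFin n} v∈))
        (v∉R , att)          = nice-or-tent-attached E R v nice-or-tent
    in v∉R , T-not⇒∉ v∉X , att

  η+τ≤#candidates+∣X∣ : η E R + τ E R ≤ length candidates + ∣ X ∣
  η+τ≤#candidates+∣X∣ = begin
    η E R + τ E R                         ≤⟨ sum-map-+-mono _ _ _ _ (allFin n)
                                               (λ v → indicator-∨ _ _ (vlookup X v) (¬nice-and-tent E R v)) ⟩
    countV candidate + countV (vlookup X) ≡⟨ cong₂ ℕ._+_ (sym (length-filterᵇ candidate (allFin n)))
                                                         (countV-∣∣ X) ⟩
    length candidates + ∣ X ∣             ∎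
    where open ℕ.≤-Reasoning

lemma2 : ∀ (n : ℕ) (E : Edges n) (w : Fin n → ℕ) (k : ℕ) → 1 ≤ k →
    (R : Subset n) → IsFVS E R → ∣ R ∣ ≡ k + 1 →
    (ρ : ℕ) → NumComponents E R ρ →
    ((+ k) Data.Integer.+ (+ ρ)) - (+ (η E R + τ E R)) < + 0 →
    ¬ (∃ λ (X : Subset n) → (∀ {v} → v Data.Fin.Subset.∈ X → v ∉ R)
         × ∣ X ∣ ≤ k × IsForestMinus E X)
lemma2 n E _ k _ R _ _ ρ (component , same-component⇔reach , _) μ<0 (X , X∩R=∅ , ∣X∣≤k , forest) =
  forest (cycle-of-attached E ρ R component connected id (λ x∈R x∈X → X∩R=∅ x∈X x∈R)
            (candidates E R X) (candidates-unique E R X)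
            (All.tabulate (proj₁ ∘ candidate-attached E R X)) (All.tabulate (proj₂ ∘ candidate-attached E R X))
            ρ<#candidates)
  where
  connected : ClassesConnected E R component
  connected u∈R v∈R = Equivalence.to (same-component⇔reach _ _ u∈R v∈R)

  #candidates = length (candidates E R X)

  ρ<#candidates : ρ ℕ.< #candidates
  ρ<#candidates = ℕ.+-cancelˡ-< k ρ #candidates (begin-strict
    k + ρ               <⟨ m-n<0⇒m<n (k + ρ) (η E R + τ E R) μ<0 ⟩
    η E R + τ E R       ≤⟨ η+τ≤#candidates+∣X∣ E R X ⟩
    #candidates + ∣ X ∣ ≤⟨ ℕ.+-monoʳ-≤ #candidates ∣X∣≤k ⟩
    #candidates + k     ≡⟨ ℕ.+-comm #candidates k ⟩
    k + #candidates     ∎)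
    where open ℕ.≤-Reasoning
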